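{- For every $v\equiv 1,3 \pmod 6$ with $v\geq 7$, there exists a DTS$(v)$ having no $v$-good sequencing.
   Context: A transitive triple is an ordered triple $(x,y,z)$ of distinct elements; it contains the directed edges $(x,y)$, $(x,z)$, $(y,z)$. A directed triple system of order $v$, DTS$(v)$, is a pair $(X,\mathcal{B})$ where $X$ is a set of $v$ points and $\mathcal{B}$ is a set of transitive triples of elements of $X$ such that every ordered pair $(a,b)$ of distinct points of $X$ occurs as a directed edge in exactly one triple of $\mathcal{B}$. A $v$-good sequencing of a DTS$(v)$ $(X,\mathcal{B})$ is a permutation $[x_1\, x_2\, \cdots\, x_v]$ of $X$ such that for no triple $(x,y,z)\in\mathcal{B}$ do we have $x=x_i$, $y=x_j$, $z=x_k$ with $i<j<k$. -}

module Defs where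

open import Data.Nat using (ℕ; _≡ᵇ_)
open import Data.Fin using (Fin; _<_; _≟_)
open import Data.List using (List; length; filter)
open import Data.Product using (_×_; Σ; ∃; _,_)
open import Function.Bundles using (_⤖_; Bijection)
open import Relation.Binary.PropositionalEquality using (_≡_; _≢_)
open import Relation.Nullary using (¬_; Dec; yes; no)
open import Relation.Nullary.Decidable using (_⊎-dec_; _×-dec_)
open import Data.Sum using (_⊎_)
open import Data.List.Membership.Propositional using (_∈_)

record TransTriple (v : ℕ) : Set where
  constructor ⟨_,_,_⟩
  field
    fst snd thd : Fin v
    fst≢snd : fst ≢ snd
    fst≢thd : fst ≢ thd
    snd≢thd : snd ≢ thd
open TransTriple public

HasEdge : ∀ {v} → TransTriple v → Fin v → Fin v → Set
HasEdge t a b =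
  (fst t ≡ a × snd t ≡ b) ⊎ (fst t ≡ a × thd t ≡ b) ⊎ (snd t ≡ a × thd t ≡ b)

hasEdge? : ∀ {v} (t : TransTriple v) (a b : Fin v) → Dec (HasEdge t a b)
hasEdge? t a b =
  ((fst t ≟ a) ×-dec (snd t ≟ b)) ⊎-dec
  (((fst t ≟ a) ×-dec (thd t ≟ b)) ⊎-dec ((snd t ≟ a) ×-dec (thd t ≟ b)))

edgeCount : ∀ {v} → List (TransTriple v) → Fin v → Fin v → ℕ
edgeCount B a b = length (filter (λ t → hasEdge? t a b) B)

-- DTS(v) on the point set X = Fin v: every ordered pair of distinct points
-- occurs as a directed edge in exactly one block.  (Counting with multiplicity,
-- this also forces the blocks to be pairwise distinct, i.e. B is a set.)
IsDTS : (v : ℕ) → List (TransTriple v) → Set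
IsDTS v B = ∀ (a b : Fin v) → a ≢ b → edgeCount B a b ≡ 1

IsGoodSequencing : ∀ {v} → List (TransTriple v) → (Fin v ⤖ Fin v) → Set
IsGoodSequencing {v} B σ =
  ∀ (t : TransTriple v) → t ∈ B →
  ¬ (Σ (Fin v) λ i → Σ (Fin v) λ j → Σ (Fin v) λ k →
       i < j × j < k × Bijection.to σ i ≡ fst t × Bijection.to σ j ≡ snd t × Bijection.to σ k ≡ thd t)

-- Doubling: given a DTS(v) B on X with no good sequencing and c ∈ {0, 3}, put the cyclic group
-- Z_m, m = v + 2c + 1, beside X.  The triples (t, x, t + c + 1 + x) for x ∈ X, t ∈ Z_m cover every
-- pair between X and Z_m and every pair of Z_m whose difference lies in c+1 … c+v; the remaining
-- differences ±1 … ±c are covered by the short triples (t, t+1, t+3) and (t+3, t+2, t) when c = 3.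
-- The result is a DTS(2v + 2c + 1), since it covers every ordered pair and has the right number of
-- blocks, and a good sequencing of it would restrict to one of B.  The orders 7, 9 and 13 are
-- settled by an exhaustive search, and v ↦ 2v + 1, v ↦ 2v + 7 reach every v ≡ 1, 3 (mod 6), v ≥ 7.
module Submission where

open import Defs
open import Data.Bool using (if_then_else_)
import Data.Bool.Properties as Bool
open import Data.Fin using (Fin; zero; suc; toℕ; fromℕ<; _↑ˡ_; _↑ʳ_; splitAt; #_; _≟_)
open import Data.Fin.Properties
  using ( toℕ-fromℕ<; toℕ-injective; toℕ<n; ↑ˡ-injective; ↑ʳ-injective
        ; splitAt-↑ˡ; splitAt-↑ʳ; splitAt⁻¹-↑ˡ; splitAt⁻¹-↑ʳ; all?)
open import Data.Fin.Subset using (Subset; ⊥; ⁅_⁆; _∪_; ∣_∣; ∁; inside; outside)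
  renaming (_∈_ to _∈ₛ_; _∉_ to _∉ₛ_)
open import Data.Fin.Subset.Properties
  using ( ∉⊥; ∣⊥∣≡0; x∈⁅x⁆; x∈⁅y⁆⇒x≡y; x∈p∪q⁺; x∈p∪q⁻; x∈∁p⇒x∉p; nonempty?; Empty-unique
        ; ∣∁p∣≡n∸∣p∣; ∪-identityʳ)
  renaming (_∈?_ to _∈ₛ?_)
open import Data.List
  using (List; []; _∷_; length; map; filter; concatMap; deduplicate; allFin; _++_; cartesianProductWith)
open import Data.List.Properties using (filter-some; filter-none; length-++; length-map; length-tabulate)
open import Data.List.Relation.Unary.Any using (Any; any?)
import Data.List.Relation.Unary.Any as Any
import Data.List.Relation.Unary.Any.Properties as Any
import Data.List.Relation.Unary.All as All
open import Data.List.Relation.Unary.All.Properties using (¬Any⇒All¬; all-filter)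
open import Data.List.Membership.Propositional using (_∈_; find; lose)
open import Data.List.Membership.Propositional.Properties
  using (∈-map⁺; ∈-filter⁺; ∈-allFin; ∈-concatMap⁺; ∈-deduplicate⁺; ∈-cartesianProductWith⁺)
open import Data.List.Extrema.Nat using (argmin; argmin-all; f[argmin]≤f[xs])
open import Data.Nat using (ℕ; zero; suc; _+_; _*_; _∸_; _≤_; _<_; _≥_; _%_; _/_; _≤?_; z≤n; s≤s; NonZero)
open import Data.Nat.DivMod
  using (m%n<n; [m+n]%n≡m%n; %-distribˡ-+; m%n%n≡m%n; m<n⇒m%n≡m; m≡m%n+[m/n]*n)
open import Data.Nat.Induction using (<-rec)
open import Data.Nat.Properties
  using ( +-assoc; +-comm; +-identityʳ; +-suc; *-zeroʳ; *-identityʳ; *-suc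
        ; +-cancelˡ-≡; +-cancelʳ-≡; +-cancelˡ-≤; +-mono-≤; +-mono-<-≤; +-monoʳ-<
        ; ≤-refl; ≤-reflexive; ≤-trans; ≤-antisym; ≤-<-trans; <⇒≤; <⇒≢; <⇒≱; ≮⇒≥; ≰⇒>; <-irrefl; ≤∧≢⇒<
        ; m≤m+n; n≤1+n; m<n⇒0<n∸m; m>n⇒m∸n≢0; n≢0⇒n>0; m∸n+n≡m; m+[n∸m]≡n; m+n∸m≡n; m∸[m∸n]≡n; m∸n≤m
        ; ∸-monoʳ-≤; _<?_; +-*-semiring)
  renaming (_≟_ to _≟ℕ_)
open import Algebra.Properties.Semiring.Sum +-*-semiring
  using (sum; sum-cong-≗; ∑-distrib-+; *-distribˡ-sum; sum-replicate-zero)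
open import Data.Nat.Tactic.RingSolver using (solve-∀)
open import Data.Product using (Σ; ∃; _×_; _,_; proj₁; proj₂)
open import Data.Sum using (_⊎_; inj₁; inj₂) renaming (map to ⊎-map)
open import Data.Vec using (_∷_) renaming (here to hereᵥ; there to thereᵥ)
open import Data.Vec.Properties using (≡-dec)
open import Function using (_∘_)
open import Function.Bundles using (_⤖_; Bijection; Surjection)
open import Function.Definitions using (Injective)
open import Relation.Nullary using (¬_; Dec; yes; no; does; ¬?; contradiction)
open import Relation.Nullary.Decidable using (True; toWitness; _×-dec_; _⊎-dec_; _→-dec_)
open import Relation.Binary.PropositionalEquality using (_≡_; _≢_; refl; sym; trans; cong; cong₂; subst)
open Relation.Binary.PropositionalEquality.≡-Reasoning

-- Translation in Z_m

module _ {m : ℕ} .{{_ : NonZero m}} where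

  [m%n+k]%n≡[m+k]%n : ∀ a b → (a % m + b) % m ≡ (a + b) % m
  [m%n+k]%n≡[m+k]%n a b = begin
    (a % m + b) % m         ≡⟨ %-distribˡ-+ (a % m) b m ⟩
    (a % m % m + b % m) % m ≡⟨ cong (λ n → (n + b % m) % m) (m%n%n≡m%n a m) ⟩
    (a % m + b % m) % m     ≡⟨ %-distribˡ-+ a b m ⟨
    (a + b) % m             ∎

  [k+[m∸t]+t]%m≡k%m : ∀ a (t : Fin m) → (a + (m ∸ toℕ t) + toℕ t) % m ≡ a % m
  [k+[m∸t]+t]%m≡k%m a t = begin
    (a + (m ∸ toℕ t) + toℕ t) % m ≡⟨ cong (_% m) (+-assoc a (m ∸ toℕ t) (toℕ t)) ⟩
    (a + (m ∸ toℕ t + toℕ t)) % m ≡⟨ cong (λ n → (a + n) % m) (m∸n+n≡m (<⇒≤ (toℕ<n t))) ⟩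
    (a + m) % m                   ≡⟨ [m+n]%n≡m%n a m ⟩
    a % m                         ∎

  infixl 6 _⊕_ _⊖_

  _⊕_ : Fin m → ℕ → Fin m
  t ⊕ a = fromℕ< (m%n<n (toℕ t + a) m)

  _⊖_ : Fin m → ℕ → Fin m
  t ⊖ a = t ⊕ (m ∸ a)

  toℕ-⊕ : ∀ t a → toℕ (t ⊕ a) ≡ (toℕ t + a) % m
  toℕ-⊕ t a = toℕ-fromℕ< (m%n<n (toℕ t + a) m)

  ⊕-assoc : ∀ t a b → t ⊕ a ⊕ b ≡ t ⊕ (a + b)
  ⊕-assoc t a b = toℕ-injective (begin
    toℕ (t ⊕ a ⊕ b)           ≡⟨ toℕ-⊕ (t ⊕ a) b ⟩
    (toℕ (t ⊕ a) + b) % m     ≡⟨ cong (λ n → (n + b) % m) (toℕ-⊕ t a) ⟩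
    ((toℕ t + a) % m + b) % m ≡⟨ [m%n+k]%n≡[m+k]%n (toℕ t + a) b ⟩
    (toℕ t + a + b) % m       ≡⟨ cong (_% m) (+-assoc (toℕ t) a b) ⟩
    (toℕ t + (a + b)) % m     ≡⟨ toℕ-⊕ t (a + b) ⟨
    toℕ (t ⊕ (a + b))         ∎)

  ⊕-identityʳ : ∀ t → t ⊕ 0 ≡ t
  ⊕-identityʳ t = toℕ-injective (begin
    toℕ (t ⊕ 0)     ≡⟨ toℕ-⊕ t 0 ⟩
    (toℕ t + 0) % m ≡⟨ cong (_% m) (+-identityʳ (toℕ t)) ⟩
    toℕ t % m       ≡⟨ m<n⇒m%n≡m (toℕ<n t) ⟩
    toℕ t           ∎)

  ⊕-period : ∀ t a → t ⊕ (a + m) ≡ t ⊕ a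
  ⊕-period t a = toℕ-injective (begin
    toℕ (t ⊕ (a + m))     ≡⟨ toℕ-⊕ t (a + m) ⟩
    (toℕ t + (a + m)) % m ≡⟨ cong (_% m) (+-assoc (toℕ t) a m) ⟨
    (toℕ t + a + m) % m   ≡⟨ [m+n]%n≡m%n (toℕ t + a) m ⟩
    (toℕ t + a) % m       ≡⟨ toℕ-⊕ t a ⟨
    toℕ (t ⊕ a)           ∎)

  ⊕-⊖ : ∀ t a → a ≤ m → t ⊕ a ⊖ a ≡ t
  ⊕-⊖ t a a≤m = begin
    t ⊕ a ⊕ (m ∸ a)   ≡⟨ ⊕-assoc t a (m ∸ a) ⟩
    t ⊕ (a + (m ∸ a)) ≡⟨ cong (t ⊕_) (m+[n∸m]≡n a≤m) ⟩
    t ⊕ (0 + m)       ≡⟨ ⊕-period t 0 ⟩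
    t ⊕ 0             ≡⟨ ⊕-identityʳ t ⟩
    t                 ∎

  ⊖-⊕ : ∀ t a → a ≤ m → t ⊖ a ⊕ a ≡ t
  ⊖-⊕ t a a≤m = begin
    t ⊕ (m ∸ a) ⊕ a       ≡⟨ cong (t ⊕ (m ∸ a) ⊕_) (m∸[m∸n]≡n a≤m) ⟨
    t ⊕ (m ∸ a) ⊖ (m ∸ a) ≡⟨ ⊕-⊖ t (m ∸ a) (m∸n≤m m a) ⟩
    t                     ∎

  ⊖-⊕-+ : ∀ t a b → a ≤ m → t ⊖ a ⊕ (a + b) ≡ t ⊕ b
  ⊖-⊕-+ t a b a≤m = trans (sym (⊕-assoc (t ⊖ a) a b)) (cong (_⊕ b) (⊖-⊕ t a a≤m))

  ⊕-cancelˡ : ∀ t a b → t ⊕ a ≡ t ⊕ b → a % m ≡ b % m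
  ⊕-cancelˡ t a b eq = begin
    a % m                     ≡⟨ shift-back a ⟨
    toℕ (t ⊕ a ⊕ (m ∸ toℕ t)) ≡⟨ cong (λ s → toℕ (s ⊕ (m ∸ toℕ t))) eq ⟩
    toℕ (t ⊕ b ⊕ (m ∸ toℕ t)) ≡⟨ shift-back b ⟩
    b % m                     ∎
    where
    shift-back : ∀ a → toℕ (t ⊕ a ⊕ (m ∸ toℕ t)) ≡ a % m
    shift-back a = begin
      toℕ (t ⊕ a ⊕ (m ∸ toℕ t))       ≡⟨ cong toℕ (⊕-assoc t a (m ∸ toℕ t)) ⟩
      toℕ (t ⊕ (a + (m ∸ toℕ t)))     ≡⟨ toℕ-⊕ t (a + (m ∸ toℕ t)) ⟩
      (toℕ t + (a + (m ∸ toℕ t))) % m ≡⟨ cong (_% m) (+-comm (toℕ t) (a + (m ∸ toℕ t))) ⟩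
      (a + (m ∸ toℕ t) + toℕ t) % m   ≡⟨ [k+[m∸t]+t]%m≡k%m a t ⟩
      a % m                           ∎

  ⊕-≢ : ∀ t a → 0 < a → a < m → t ⊕ a ≢ t
  ⊕-≢ t a 0<a a<m eq = <⇒≢ 0<a (begin
    0     ≡⟨ m<n⇒m%n≡m (≤-<-trans z≤n a<m) ⟨
    0 % m ≡⟨ ⊕-cancelˡ t 0 a (trans (⊕-identityʳ t) (sym eq)) ⟩
    a % m ≡⟨ m<n⇒m%n≡m a<m ⟩
    a     ∎)

  ⊕-≢-⊕ : ∀ t a b → a < b → b < m → t ⊕ a ≢ t ⊕ b
  ⊕-≢-⊕ t a b a<b b<m eq = ⊕-≢ (t ⊕ a) (b ∸ a) (m<n⇒0<n∸m a<b) (≤-<-trans (m∸n≤m b a) b<m) (begin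
    t ⊕ a ⊕ (b ∸ a)   ≡⟨ ⊕-assoc t a (b ∸ a) ⟩
    t ⊕ (a + (b ∸ a)) ≡⟨ cong (t ⊕_) (m+[n∸m]≡n (<⇒≤ a<b)) ⟩
    t ⊕ b             ≡⟨ eq ⟨
    t ⊕ a             ∎)

  difference : ∀ s t → ∃ λ δ → δ < m × s ⊕ δ ≡ t
  difference s t = δ , m%n<n _ m , toℕ-injective (begin
    toℕ (s ⊕ δ)                       ≡⟨ toℕ-⊕ s δ ⟩
    (toℕ s + δ) % m                   ≡⟨ cong (_% m) (+-comm (toℕ s) δ) ⟩
    (δ + toℕ s) % m                   ≡⟨ [m%n+k]%n≡[m+k]%n (toℕ t + (m ∸ toℕ s)) (toℕ s) ⟩
    (toℕ t + (m ∸ toℕ s) + toℕ s) % m ≡⟨ [k+[m∸t]+t]%m≡k%m (toℕ t) s ⟩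
    toℕ t % m                         ≡⟨ m<n⇒m%n≡m (toℕ<n t) ⟩
    toℕ t                             ∎)
    where
    δ : ℕ
    δ = (toℕ t + (m ∸ toℕ s)) % m

-- Counting edges

𝟙 : ∀ {P : Set} → Dec P → ℕ
𝟙 p = if does p then 1 else 0

𝟙-yes : ∀ {P : Set} (p : Dec P) → P → 𝟙 p ≡ 1
𝟙-yes (yes _) _  = refl
𝟙-yes (no ¬p) p = contradiction p ¬p

𝟙-¬? : ∀ {P : Set} (p : Dec P) → 𝟙 (¬? p) + 𝟙 p ≡ 1
𝟙-¬? (yes _) = refl
𝟙-¬? (no _)  = refl

𝟙-× : ∀ {P Q : Set} (p : Dec P) (q : Dec Q) → 𝟙 (p ×-dec q) ≡ 𝟙 p * 𝟙 q
𝟙-× (yes _) (yes _) = refl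
𝟙-× (yes _) (no _)  = refl
𝟙-× (no _)  _       = refl

𝟙-⊎ : ∀ {P Q : Set} (p : Dec P) (q : Dec Q) → ¬ (P × Q) → 𝟙 (p ⊎-dec q) ≡ 𝟙 p + 𝟙 q
𝟙-⊎ (yes p) (yes q) ¬pq = contradiction (p , q) ¬pq
𝟙-⊎ (yes _) (no _)  _   = refl
𝟙-⊎ (no _)  (yes _) _   = refl
𝟙-⊎ (no _)  (no _)  _   = refl

length-filter-∷ : ∀ {A : Set} {P : A → Set} (P? : ∀ x → Dec (P x)) x xs →
                  length (filter P? (x ∷ xs)) ≡ 𝟙 (P? x) + length (filter P? xs)
length-filter-∷ P? x xs with P? x
... | yes _ = refl
... | no _  = refl

sum-const : ∀ n k → sum {n} (λ _ → k) ≡ n * k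
sum-const zero    k = refl
sum-const (suc n) k = cong (k +_) (sum-const n k)

sum-𝟙-≟ : ∀ {n} (y : Fin n) → sum {n} (λ b → 𝟙 (y ≟ b)) ≡ 1
sum-𝟙-≟ {suc n} zero    = cong suc (trans (sum-const n 0) (*-zeroʳ n))
sum-𝟙-≟ {suc n} (suc y) = sum-𝟙-≟ y

+-mono-≤-≡ : ∀ {a b c d} → a ≤ c → b ≤ d → a + b ≡ c + d → a ≡ c × b ≡ d
+-mono-≤-≡ {a} {b} {c} {d} a≤c b≤d eq = a≡c , +-cancelˡ-≡ c b d (trans (cong (_+ b) (sym a≡c)) eq)
  where
  a≡c : a ≡ c
  a≡c = ≤-antisym a≤c (≮⇒≥ (λ a<c → <-irrefl eq (+-mono-<-≤ a<c b≤d)))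

sum-mono-≤ : ∀ {n} {f g : Fin n → ℕ} → (∀ i → f i ≤ g i) → sum f ≤ sum g
sum-mono-≤ {zero}  f≤g = z≤n
sum-mono-≤ {suc n} f≤g = +-mono-≤ (f≤g zero) (sum-mono-≤ (f≤g ∘ suc))

sum-mono-≤-≡ : ∀ {n} {f g : Fin n → ℕ} → (∀ i → f i ≤ g i) → sum f ≡ sum g → ∀ i → f i ≡ g i
sum-mono-≤-≡ {suc n} f≤g eq zero    = proj₁ (+-mono-≤-≡ (f≤g zero) (sum-mono-≤ (f≤g ∘ suc)) eq)
sum-mono-≤-≡ {suc n} f≤g eq (suc i) =
  sum-mono-≤-≡ (f≤g ∘ suc) (proj₂ (+-mono-≤-≡ (f≤g zero) (sum-mono-≤ (f≤g ∘ suc)) eq)) i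

∑∑ : ∀ {v} → (Fin v → Fin v → ℕ) → ℕ
∑∑ {v} f = sum {v} (λ a → sum {v} (f a))

∑∑-cong : ∀ {v} {f g : Fin v → Fin v → ℕ} → (∀ a b → f a b ≡ g a b) → ∑∑ f ≡ ∑∑ g
∑∑-cong {v} f≡g = sum-cong-≗ {v} (λ a → sum-cong-≗ {v} (f≡g a))

∑∑-+ : ∀ {v} (f g : Fin v → Fin v → ℕ) → ∑∑ (λ a b → f a b + g a b) ≡ ∑∑ f + ∑∑ g
∑∑-+ {v} f g = trans (sum-cong-≗ {v} (λ a → ∑-distrib-+ (f a) (g a))) (∑-distrib-+ {v} _ _)

∑∑-zero : ∀ v → ∑∑ {v} (λ _ _ → 0) ≡ 0
∑∑-zero v = trans (sum-cong-≗ {v} (λ _ → sum-replicate-zero v)) (sum-replicate-zero v)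

∑∑-𝟙-≟ : ∀ {v} (p q : Fin v) → ∑∑ (λ a b → 𝟙 (p ≟ a) * 𝟙 (q ≟ b)) ≡ 1
∑∑-𝟙-≟ {v} p q = trans (sum-cong-≗ {v} row) (sum-𝟙-≟ p)
  where
  row : ∀ a → sum {v} (λ b → 𝟙 (p ≟ a) * 𝟙 (q ≟ b)) ≡ 𝟙 (p ≟ a)
  row a = begin
    sum {v} (λ b → 𝟙 (p ≟ a) * 𝟙 (q ≟ b)) ≡⟨ *-distribˡ-sum (𝟙 (p ≟ a)) (λ b → 𝟙 (q ≟ b)) ⟨
    𝟙 (p ≟ a) * sum {v} (λ b → 𝟙 (q ≟ b)) ≡⟨ cong (𝟙 (p ≟ a) *_) (sum-𝟙-≟ q) ⟩
    𝟙 (p ≟ a) * 1                         ≡⟨ *-identityʳ (𝟙 (p ≟ a)) ⟩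
    𝟙 (p ≟ a)                             ∎

offDiagonal : ∀ {v} → Fin v → Fin v → ℕ
offDiagonal a b = 𝟙 (¬? (a ≟ b))

∑∑-offDiagonal : ∀ v → ∑∑ (offDiagonal {v}) + v ≡ v * v
∑∑-offDiagonal v = begin
  ∑∑ (offDiagonal {v}) + v                 ≡⟨ cong (∑∑ (offDiagonal {v}) +_) (sum-ones v) ⟨
  ∑∑ (offDiagonal {v}) + sum {v} (λ _ → 1) ≡⟨ ∑-distrib-+ {v} _ (λ _ → 1) ⟨
  sum {v} (λ a → sum (offDiagonal a) + 1)  ≡⟨ sum-cong-≗ {v} row ⟩
  sum {v} (λ _ → v)                        ≡⟨ sum-const v v ⟩
  v * v                                    ∎
  where
  sum-ones : ∀ n → sum {n} (λ _ → 1) ≡ n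
  sum-ones n = trans (sum-const n 1) (*-identityʳ n)
  row : ∀ a → sum (offDiagonal a) + 1 ≡ v
  row a = begin
    sum (offDiagonal a) + 1                     ≡⟨ cong (sum (offDiagonal a) +_) (sum-𝟙-≟ a) ⟨
    sum (offDiagonal a) + sum (λ b → 𝟙 (a ≟ b)) ≡⟨ ∑-distrib-+ (offDiagonal a) _ ⟨
    sum (λ b → offDiagonal a b + 𝟙 (a ≟ b))     ≡⟨ sum-cong-≗ {v} (λ b → 𝟙-¬? (a ≟ b)) ⟩
    sum {v} (λ _ → 1)                           ≡⟨ sum-ones v ⟩
    v                                           ∎

𝟙-hasEdge? : ∀ {v} (t : TransTriple v) a b → 𝟙 (hasEdge? t a b) ≡
  𝟙 (fst t ≟ a) * 𝟙 (snd t ≟ b) + (𝟙 (fst t ≟ a) * 𝟙 (thd t ≟ b) + 𝟙 (snd t ≟ a) * 𝟙 (thd t ≟ b))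
𝟙-hasEdge? t a b = begin
  𝟙 (xy ⊎-dec (xz ⊎-dec yz)) ≡⟨ 𝟙-⊎ xy (xz ⊎-dec yz) xy-disjoint ⟩
  𝟙 xy + 𝟙 (xz ⊎-dec yz)     ≡⟨ cong (𝟙 xy +_) (𝟙-⊎ xz yz xz-disjoint) ⟩
  𝟙 xy + (𝟙 xz + 𝟙 yz)       ≡⟨ cong₂ _+_ (𝟙-× (fst t ≟ a) (snd t ≟ b))
                                     (cong₂ _+_ (𝟙-× (fst t ≟ a) (thd t ≟ b)) (𝟙-× (snd t ≟ a) (thd t ≟ b))) ⟩
  _                           ∎
  where
  xy : Dec (fst t ≡ a × snd t ≡ b)
  xy = (fst t ≟ a) ×-dec (snd t ≟ b)
  xz : Dec (fst t ≡ a × thd t ≡ b)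
  xz = (fst t ≟ a) ×-dec (thd t ≟ b)
  yz : Dec (snd t ≡ a × thd t ≡ b)
  yz = (snd t ≟ a) ×-dec (thd t ≟ b)
  xy-disjoint : ¬ ((fst t ≡ a × snd t ≡ b) × ((fst t ≡ a × thd t ≡ b) ⊎ (snd t ≡ a × thd t ≡ b)))
  xy-disjoint ((_ , y≡b) , inj₁ (_ , z≡b)) = snd≢thd t (trans y≡b (sym z≡b))
  xy-disjoint ((x≡a , _) , inj₂ (y≡a , _)) = fst≢snd t (trans x≡a (sym y≡a))
  xz-disjoint : ¬ ((fst t ≡ a × thd t ≡ b) × (snd t ≡ a × thd t ≡ b))
  xz-disjoint ((x≡a , _) , (y≡a , _)) = fst≢snd t (trans x≡a (sym y≡a))

∑∑-𝟙-hasEdge? : ∀ {v} (t : TransTriple v) → ∑∑ (λ a b → 𝟙 (hasEdge? t a b)) ≡ 3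
∑∑-𝟙-hasEdge? t = begin
  ∑∑ (λ a b → 𝟙 (hasEdge? t a b))         ≡⟨ ∑∑-cong (𝟙-hasEdge? t) ⟩
  ∑∑ (λ a b → xy a b + (xz a b + yz a b)) ≡⟨ ∑∑-+ xy _ ⟩
  ∑∑ xy + ∑∑ (λ a b → xz a b + yz a b)    ≡⟨ cong (∑∑ xy +_) (∑∑-+ xz yz) ⟩
  ∑∑ xy + (∑∑ xz + ∑∑ yz)                 ≡⟨ cong₂ _+_ (∑∑-𝟙-≟ (fst t) (snd t))
                                                 (cong₂ _+_ (∑∑-𝟙-≟ (fst t) (thd t)) (∑∑-𝟙-≟ (snd t) (thd t))) ⟩
  3                                        ∎
  where
  xy xz yz : Fin _ → Fin _ → ℕ
  xy a b = 𝟙 (fst t ≟ a) * 𝟙 (snd t ≟ b)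
  xz a b = 𝟙 (fst t ≟ a) * 𝟙 (thd t ≟ b)
  yz a b = 𝟙 (snd t ≟ a) * 𝟙 (thd t ≟ b)

∑∑-edgeCount : ∀ {v} (B : List (TransTriple v)) → ∑∑ (edgeCount B) ≡ 3 * length B
∑∑-edgeCount {v} []      = ∑∑-zero v
∑∑-edgeCount {v} (t ∷ B) = begin
  ∑∑ (edgeCount (t ∷ B))
    ≡⟨ ∑∑-cong (λ a b → length-filter-∷ (λ t → hasEdge? t a b) t B) ⟩
  ∑∑ (λ a b → 𝟙 (hasEdge? t a b) + edgeCount B a b) ≡⟨ ∑∑-+ (λ a b → 𝟙 (hasEdge? t a b)) (edgeCount B) ⟩
  ∑∑ (λ a b → 𝟙 (hasEdge? t a b)) + ∑∑ (edgeCount B) ≡⟨ cong₂ _+_ (∑∑-𝟙-hasEdge? t) (∑∑-edgeCount B) ⟩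
  3 + 3 * length B                                   ≡⟨ *-suc 3 (length B) ⟨
  3 * length (t ∷ B)                                 ∎

edgeCount-irrefl : ∀ {v} (B : List (TransTriple v)) a → edgeCount B a a ≡ 0
edgeCount-irrefl B a =
  cong length (filter-none (λ t → hasEdge? t a a) (All.tabulate {xs = B} λ {t} _ → no-loop t))
  where
  no-loop : ∀ t → ¬ HasEdge t a a
  no-loop t (inj₁ (x≡a , y≡a))        = fst≢snd t (trans x≡a (sym y≡a))
  no-loop t (inj₂ (inj₁ (x≡a , z≡a))) = fst≢thd t (trans x≡a (sym z≡a))
  no-loop t (inj₂ (inj₂ (y≡a , z≡a))) = snd≢thd t (trans y≡a (sym z≡a))

Covers : ∀ {v} → List (TransTriple v) → Set
Covers {v} B = ∀ (a b : Fin v) → a ≢ b → Any (λ t → HasEdge t a b) B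

isDTS⇒covers : ∀ {v} {B : List (TransTriple v)} → IsDTS v B → Covers B
isDTS⇒covers {B = B} dts a b a≢b with any? (λ t → hasEdge? t a b) B
... | yes edge = edge
... | no ¬edge = contradiction
  (trans (sym (dts a b a≢b)) (cong length (filter-none (λ t → hasEdge? t a b) (¬Any⇒All¬ B ¬edge)))) λ ()

isDTS⇒size : ∀ {v} {B : List (TransTriple v)} → IsDTS v B → 3 * length B + v ≡ v * v
isDTS⇒size {v} {B} dts = begin
  3 * length B + v         ≡⟨ cong (_+ v) (∑∑-edgeCount B) ⟨
  ∑∑ (edgeCount B) + v     ≡⟨ cong (_+ v) (∑∑-cong count) ⟩
  ∑∑ (offDiagonal {v}) + v ≡⟨ ∑∑-offDiagonal v ⟩
  v * v                    ∎
  where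
  count : ∀ a b → edgeCount B a b ≡ offDiagonal a b
  count a b with a ≟ b
  ... | yes refl = edgeCount-irrefl B a
  ... | no a≢b   = dts a b a≢b

covers⇒isDTS : ∀ {v} {B : List (TransTriple v)} → Covers B → 3 * length B + v ≡ v * v → IsDTS v B
covers⇒isDTS {v} {B} cov size a b a≢b = begin
  edgeCount B a b ≡⟨ sum-mono-≤-≡ (lower a) (sum-mono-≤-≡ (λ a → sum-mono-≤ (lower a)) total a) b ⟨
  offDiagonal a b ≡⟨ 𝟙-yes (¬? (a ≟ b)) a≢b ⟩
  1               ∎
  where
  lower : ∀ a b → offDiagonal a b ≤ edgeCount B a b
  lower a b with a ≟ b
  ... | yes _  = z≤n
  ... | no a≢b = filter-some (λ t → hasEdge? t a b) (cov a b a≢b)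
  total : ∑∑ (offDiagonal {v}) ≡ ∑∑ (edgeCount B)
  total = +-cancelʳ-≡ v _ _ (begin
    ∑∑ (offDiagonal {v}) + v ≡⟨ ∑∑-offDiagonal v ⟩
    v * v                    ≡⟨ size ⟨
    3 * length B + v         ≡⟨ cong (_+ v) (∑∑-edgeCount B) ⟨
    ∑∑ (edgeCount B) + v ∎)

-- Sequencings as rankings

Increasing : ∀ {v} → (Fin v → ℕ) → TransTriple v → Set
Increasing r t = r (fst t) < r (snd t) × r (snd t) < r (thd t)

increasing? : ∀ {v} (r : Fin v → ℕ) (t : TransTriple v) → Dec (Increasing r t)
increasing? r t = (r (fst t) <? r (snd t)) ×-dec (r (snd t) <? r (thd t))

-- Ranks are arbitrary injections into ℕ, not positions in Fin v, so that the property restricts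
-- along an embedding of the point set.
Unsequenceable : ∀ {v} → List (TransTriple v) → Set
Unsequenceable {v} B = ∀ (r : Fin v → ℕ) → Injective _≡_ _≡_ r → Any (Increasing r) B

unsequenceable⇒¬good : ∀ {v} {B : List (TransTriple v)} → Unsequenceable B → ∀ σ → ¬ IsGoodSequencing B σ
unsequenceable⇒¬good {v} {B} unseq σ good = refute (find (unseq position position-injective))
  where
  open Surjection (Bijection.surjection σ) using (to; to⁻; to∘to⁻)
  position : Fin v → ℕ
  position = toℕ ∘ to⁻
  position-injective : Injective _≡_ _≡_ position
  position-injective {a} {b} eq = trans (sym (to∘to⁻ a)) (trans (cong to (toℕ-injective eq)) (to∘to⁻ b))
  refute : ¬ (∃ λ t → t ∈ B × Increasing position t)
  refute (t , t∈B , x<y , y<z) =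
    good t t∈B (to⁻ (fst t) , to⁻ (snd t) , to⁻ (thd t) , x<y , y<z , to∘to⁻ _ , to∘to⁻ _ , to∘to⁻ _)

-- Searching for a good sequencing

∣p∪⁅x⁆∣≡1+∣p∣ : ∀ {n} {p : Subset n} {x} → x ∉ₛ p → ∣ p ∪ ⁅ x ⁆ ∣ ≡ suc ∣ p ∣
∣p∪⁅x⁆∣≡1+∣p∣ {p = outside ∷ p} {zero}  _   = cong (suc ∘ ∣_∣) (∪-identityʳ p)
∣p∪⁅x⁆∣≡1+∣p∣ {p = inside  ∷ p} {zero}  x∉p = contradiction hereᵥ x∉p
∣p∪⁅x⁆∣≡1+∣p∣ {p = outside ∷ p} {suc x} x∉p = ∣p∪⁅x⁆∣≡1+∣p∣ (x∉p ∘ thereᵥ)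
∣p∪⁅x⁆∣≡1+∣p∣ {p = inside  ∷ p} {suc x} x∉p = cong suc (∣p∪⁅x⁆∣≡1+∣p∣ (x∉p ∘ thereᵥ))

x∉p∪⁅y⁆⁻ : ∀ {n} {p : Subset n} {x y} → x ∉ₛ p ∪ ⁅ y ⁆ → x ∉ₛ p × x ≢ y
x∉p∪⁅y⁆⁻ {x = x} x∉ = x∉ ∘ x∈p∪q⁺ ∘ inj₁ , λ { refl → x∉ (x∈p∪q⁺ (inj₂ (x∈⁅x⁆ x))) }

∣p∣<n⇒∃∉ : ∀ {n} (p : Subset n) → ∣ p ∣ < n → ∃ λ x → x ∉ₛ p
∣p∣<n⇒∃∉ {n} p ∣p∣<n with nonempty? (∁ p)
... | yes (x , x∈∁p) = x , x∈∁p⇒x∉p x∈∁p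
... | no  ∁p-empty   = contradiction
  (trans (sym (∣∁p∣≡n∸∣p∣ p)) (trans (cong ∣_∣ (Empty-unique ∁p-empty)) (∣⊥∣≡0 n))) (m>n⇒m∸n≢0 ∣p∣<n)

-- layer k contains the set of the first k points of every good sequencing: y may be placed after
-- the points of S unless some block (x, y, z) has x in S and z neither in S nor y.
module Search {n : ℕ} (B : List (TransTriple n)) where

  Blocked : Subset n → Fin n → Set
  Blocked S y = Any (λ t → snd t ≡ y × fst t ∈ₛ S × thd t ∉ₛ S × thd t ≢ y) B

  Placeable : Subset n → Fin n → Set
  Placeable S y = y ∉ₛ S × ¬ Blocked S y

  placeable? : ∀ S y → Dec (Placeable S y)
  placeable? S y = ¬? (y ∈ₛ? S) ×-dec
    ¬? (any? (λ t → (snd t ≟ y) ×-dec (fst t ∈ₛ? S) ×-dec ¬? (thd t ∈ₛ? S) ×-dec ¬? (thd t ≟ y)) B)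

  successors : Subset n → List (Subset n)
  successors S = map (λ y → S ∪ ⁅ y ⁆) (filter (placeable? S) (allFin n))

  layer : ℕ → List (Subset n)
  layer zero    = ⊥ ∷ []
  layer (suc k) = deduplicate (≡-dec Bool._≟_) (concatMap successors (layer k))

  module _ (r : Fin n → ℕ) (r-injective : Injective _≡_ _≡_ r) (¬increasing : ¬ Any (Increasing r) B) where

    DownSet : Subset n → Set
    DownSet S = ∀ {a b} → a ∈ₛ S → b ∉ₛ S → r a < r b

    MinimalOutside : Subset n → Fin n → Set
    MinimalOutside S y = y ∉ₛ S × (∀ {z} → z ∉ₛ S → r y ≤ r z)

    minimalOutside : ∀ S → ∣ S ∣ < n → ∃ (MinimalOutside S)
    minimalOutside S ∣S∣<n with ∣p∣<n⇒∃∉ S ∣S∣<n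
    ... | x , x∉S =
      argmin r x outsiders ,
      argmin-all r {P = _∉ₛ S} x∉S (all-filter outside? (allFin n)) ,
      λ z∉S → All.lookup (f[argmin]≤f[xs] x outsiders) (∈-filter⁺ outside? (∈-allFin _) z∉S)
      where
      outside? : ∀ z → Dec (z ∉ₛ S)
      outside? z = ¬? (z ∈ₛ? S)
      outsiders : List (Fin n)
      outsiders = filter outside? (allFin n)

    rank-minimal : ∀ {S y z} → MinimalOutside S y → z ∉ₛ S → z ≢ y → r y < r z
    rank-minimal (_ , minimal) z∉S z≢y = ≤∧≢⇒< (minimal z∉S) (λ eq → z≢y (sym (r-injective eq)))

    extend-downSet : ∀ {S y} → DownSet S → MinimalOutside S y → DownSet (S ∪ ⁅ y ⁆)
    extend-downSet {S} {y} down y-min a∈S∪y b∉S∪y with x∈p∪q⁻ S ⁅ y ⁆ a∈S∪y | x∉p∪⁅y⁆⁻ b∉S∪y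
    ... | inj₁ a∈S | b∉S , _   = down a∈S b∉S
    ... | inj₂ a∈y | b∉S , b≢y rewrite x∈⁅y⁆⇒x≡y y a∈y = rank-minimal y-min b∉S b≢y

    placeable : ∀ {S y} → DownSet S → MinimalOutside S y → Placeable S y
    placeable {S} {y} down y-min =
      proj₁ y-min , λ blocked → ¬increasing (Any.map (λ {t} → increasing {t}) blocked)
      where
      increasing : ∀ {t} → snd t ≡ y × fst t ∈ₛ S × thd t ∉ₛ S × thd t ≢ y → Increasing r t
      increasing (refl , x∈S , z∉S , z≢y) = down x∈S (proj₁ y-min) , rank-minimal y-min z∉S z≢y

    downSet∈layer : ∀ k → k ≤ n → ∃ λ S → S ∈ layer k × ∣ S ∣ ≡ k × DownSet S
    downSet∈layer zero    _   = ⊥ , Any.here refl , ∣⊥∣≡0 n , λ a∈⊥ → contradiction a∈⊥ ∉⊥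
    downSet∈layer (suc k) k<n with downSet∈layer k (≤-trans (n≤1+n k) k<n)
    ... | S , S∈layer , ∣S∣≡k , down with minimalOutside S (subst (_< n) (sym ∣S∣≡k) k<n)
    ... | y , y-min =
      S ∪ ⁅ y ⁆ , S∪y∈layer , trans (∣p∪⁅x⁆∣≡1+∣p∣ (proj₁ y-min)) (cong suc ∣S∣≡k) , extend-downSet down y-min
      where
      S∪y∈layer : S ∪ ⁅ y ⁆ ∈ layer (suc k)
      S∪y∈layer = ∈-deduplicate⁺ (≡-dec Bool._≟_) (∈-concatMap⁺ successors (Any.map (λ { refl →
        ∈-map⁺ (λ y → S ∪ ⁅ y ⁆) (∈-filter⁺ (placeable? S) (∈-allFin y) (placeable down y-min)) }) S∈layer))

  layer-empty⇒unsequenceable : layer n ≡ [] → Unsequenceable B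
  layer-empty⇒unsequenceable empty r r-injective with any? (increasing? r) B
  ... | yes increasing = increasing
  ... | no ¬increasing with downSet∈layer r r-injective ¬increasing n ≤-refl
  ...   | S , S∈layer , _ = contradiction (subst (S ∈_) empty S∈layer) λ ()

-- The doubling construction

length-cartesianProductWith : ∀ {A B C : Set} (f : A → B → C) xs ys →
  length (cartesianProductWith f xs ys) ≡ length xs * length ys
length-cartesianProductWith f []       ys = refl
length-cartesianProductWith f (x ∷ xs) ys = begin
  length (map (f x) ys ++ cartesianProductWith f xs ys)         ≡⟨ length-++ (map (f x) ys) ⟩
  length (map (f x) ys) + length (cartesianProductWith f xs ys)
    ≡⟨ cong₂ _+_ (length-map (f x) ys) (length-cartesianProductWith f xs ys) ⟩
  length ys + length xs * length ys                             ∎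

length-allFin : ∀ n → length (allFin n) ≡ n
length-allFin n = length-tabulate {n = n} (λ i → i)

NoGoodDTS : ℕ → Set
NoGoodDTS v = ∃ λ (B : List (TransTriple v)) → IsDTS v B × Unsequenceable B

module Doubling (v c : ℕ) where

  m : ℕ
  m = suc (c + v + c)

  w : ℕ
  w = v + m

  old : Fin v → Fin w
  old x = x ↑ˡ m

  new : Fin m → Fin w
  new y = v ↑ʳ y

  old≢new : ∀ x y → old x ≢ new y
  old≢new x y eq =
    contradiction (trans (sym (splitAt-↑ˡ v x m)) (trans (cong (splitAt v) eq) (splitAt-↑ʳ v m y))) λ ()

  data Side : Fin w → Set where
    old-point : ∀ x → Side (old x)
    new-point : ∀ y → Side (new y)

  side : ∀ a → Side a
  side a with splitAt v a in eq
  ... | inj₁ x = subst Side (splitAt⁻¹-↑ˡ eq) (old-point x)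
  ... | inj₂ y = subst Side (splitAt⁻¹-↑ʳ eq) (new-point y)

  oldTriple : TransTriple v → TransTriple w
  oldTriple t = ⟨ old (fst t) , old (snd t) , old (thd t) ⟩
    (fst≢snd t ∘ ↑ˡ-injective m _ _) (fst≢thd t ∘ ↑ˡ-injective m _ _) (snd≢thd t ∘ ↑ˡ-injective m _ _)

  oldTriple-edge : ∀ t {a b} → HasEdge t a b → HasEdge (oldTriple t) (old a) (old b)
  oldTriple-edge t (inj₁ (refl , refl))        = inj₁ (refl , refl)
  oldTriple-edge t (inj₂ (inj₁ (refl , refl))) = inj₂ (inj₁ (refl , refl))
  oldTriple-edge t (inj₂ (inj₂ (refl , refl))) = inj₂ (inj₂ (refl , refl))

  gap : Fin v → ℕ
  gap x = suc (c + toℕ x)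

  gap<m : ∀ x → gap x < m
  gap<m x = s≤s (≤-trans (+-monoʳ-< c (toℕ<n x)) (m≤m+n (c + v) c))

  gap-onto : ∀ {δ} → c < δ → δ ≤ c + v → ∃ λ x → gap x ≡ δ
  gap-onto {δ} c<δ δ≤c+v =
    fromℕ< j<v , trans (cong (λ (j : ℕ) → suc (c + j)) (toℕ-fromℕ< j<v)) (m+[n∸m]≡n c<δ)
    where
    j<v : δ ∸ suc c < v
    j<v = +-cancelˡ-≤ c _ _
      (subst (_≤ c + v) (trans (sym (m+[n∸m]≡n c<δ)) (sym (+-suc c (δ ∸ suc c)))) δ≤c+v)

  complement-short : ∀ {δ} → c + v < δ → δ < m → 0 < m ∸ δ × m ∸ δ ≤ c
  complement-short c+v<δ δ<m = m<n⇒0<n∸m δ<m , ≤-trans (∸-monoʳ-≤ m c+v<δ) (≤-reflexive (m+n∸m≡n (c + v) c))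

  crossTriple : Fin v → Fin m → TransTriple w
  crossTriple x t = ⟨ new t , old x , new (t ⊕ gap x) ⟩
    (old≢new x t ∘ sym)
    (⊕-≢ t (gap x) (s≤s z≤n) (gap<m x) ∘ sym ∘ ↑ʳ-injective v _ _)
    (old≢new x (t ⊕ gap x))

  crossTriples : List (TransTriple w)
  crossTriples = cartesianProductWith crossTriple (allFin v) (allFin m)

  crossTriple∈ : ∀ x t → crossTriple x t ∈ crossTriples
  crossTriple∈ x t = ∈-cartesianProductWith⁺ crossTriple (∈-allFin x) (∈-allFin t)

  record ShortDifferenceCover (S : List (TransTriple w)) : Set where
    field
      forward  : ∀ y δ → 0 < δ → δ ≤ c → Any (λ t → HasEdge t (new y) (new (y ⊕ δ))) S
      backward : ∀ y δ → 0 < δ → δ ≤ c → Any (λ t → HasEdge t (new (y ⊕ δ)) (new y)) S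
      size     : 3 * length S ≡ 2 * c * m

  blocks : List (TransTriple v) → List (TransTriple w) → List (TransTriple w)
  blocks B S = map oldTriple B ++ crossTriples ++ S

  module _ (B : List (TransTriple v)) (S : List (TransTriple w)) where

    private
      Edge : Fin w → Fin w → TransTriple w → Set
      Edge a b t = HasEdge t a b

      viaCross : ∀ {a b} → Any (Edge a b) crossTriples → Any (Edge a b) (blocks B S)
      viaCross = Any.++⁺ʳ (map oldTriple B) ∘ Any.++⁺ˡ

      viaShort : ∀ {a b} → Any (Edge a b) S → Any (Edge a b) (blocks B S)
      viaShort = Any.++⁺ʳ (map oldTriple B) ∘ Any.++⁺ʳ crossTriples

    new-new-cover : ShortDifferenceCover S → ∀ y δ → 0 < δ → δ < m →
                    Any (Edge (new y) (new (y ⊕ δ))) (blocks B S)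
    new-new-cover short y δ 0<δ δ<m with δ ≤? c | δ ≤? c + v
    ... | yes δ≤c | _         = viaShort (ShortDifferenceCover.forward short y δ 0<δ δ≤c)
    ... | no δ≰c  | yes δ≤c+v with gap-onto (≰⇒> δ≰c) δ≤c+v
    ...   | x , refl = viaCross (lose (crossTriple∈ x y) (inj₂ (inj₁ (refl , refl))))
    new-new-cover short y δ 0<δ δ<m | no δ≰c | no δ≰c+v with complement-short (≰⇒> δ≰c+v) δ<m
    ...   | 0<m∸δ , m∸δ≤c = viaShort (subst (λ y′ → Any (Edge (new y′) (new (y ⊕ δ))) S) (⊕-⊖ y δ (<⇒≤ δ<m))
                              (ShortDifferenceCover.backward short (y ⊕ δ) (m ∸ δ) 0<m∸δ m∸δ≤c))

    blocks-covers : ShortDifferenceCover S → Covers B → Covers (blocks B S)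
    blocks-covers short covB a b a≢b with side a | side b
    ... | old-point x₀ | old-point x₁ =
      Any.++⁺ˡ (Any.map⁺ (Any.map (λ {t} → oldTriple-edge t) (covB x₀ x₁ (a≢b ∘ cong old))))
    ... | old-point x  | new-point y  =
      viaCross (lose (crossTriple∈ x (y ⊖ gap x))
        (inj₂ (inj₂ (refl , cong new (⊖-⊕ y (gap x) (<⇒≤ (gap<m x)))))))
    ... | new-point y  | old-point x  = viaCross (lose (crossTriple∈ x y) (inj₁ (refl , refl)))
    ... | new-point y₀ | new-point y₁ with difference y₀ y₁
    ...   | δ , δ<m , refl =
      new-new-cover short y₀ δ (n≢0⇒n>0 λ { refl → a≢b (cong new (sym (⊕-identityʳ y₀))) }) δ<m

    blocks-size : ShortDifferenceCover S → 3 * length B + v ≡ v * v → 3 * length (blocks B S) + w ≡ w * w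
    blocks-size short sizeB = begin
      3 * length (blocks B S) + w                         ≡⟨ cong (λ n → 3 * n + w) length-blocks ⟩
      3 * (length B + (v * m + length S)) + (v + m)       ≡⟨ rearrange (length B) (length S) v m ⟩
      (3 * length B + v) + 3 * (v * m) + 3 * length S + m
        ≡⟨ cong₂ (λ p q → p + 3 * (v * m) + q + m) sizeB (ShortDifferenceCover.size short) ⟩
      v * v + 3 * (v * m) + 2 * c * m + m                 ≡⟨ square v c ⟩
      w * w                                               ∎
      where
      length-blocks : length (blocks B S) ≡ length B + (v * m + length S)
      length-blocks = begin
        length (map oldTriple B ++ crossTriples ++ S)         ≡⟨ length-++ (map oldTriple B) ⟩
        length (map oldTriple B) + length (crossTriples ++ S)
          ≡⟨ cong₂ _+_ (length-map oldTriple B) (length-++ crossTriples) ⟩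
        length B + (length crossTriples + length S)
          ≡⟨ cong (λ n → length B + (n + length S)) length-crossTriples ⟩
        length B + (v * m + length S)                         ∎
        where
        length-crossTriples : length crossTriples ≡ v * m
        length-crossTriples = trans (length-cartesianProductWith crossTriple (allFin v) (allFin m))
                                    (cong₂ _*_ (length-allFin v) (length-allFin m))
      rearrange : ∀ b s v m → 3 * (b + (v * m + s)) + (v + m) ≡ (3 * b + v) + 3 * (v * m) + 3 * s + m
      rearrange = solve-∀
      square : ∀ v c → let m = suc (c + v + c) in v * v + 3 * (v * m) + 2 * c * m + m ≡ (v + m) * (v + m)
      square = solve-∀

    blocks-unsequenceable : Unsequenceable B → Unsequenceable (blocks B S)
    blocks-unsequenceable unseq r r-injective =
      Any.++⁺ˡ (Any.map⁺ (unseq (r ∘ old) (↑ˡ-injective m _ _ ∘ r-injective)))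

  doubling : ∀ S → ShortDifferenceCover S → NoGoodDTS v → NoGoodDTS w
  doubling S short (B , dts , unseq) = blocks B S ,
    covers⇒isDTS (blocks-covers B S short (isDTS⇒covers dts))
                 (blocks-size B S short (isDTS⇒size {B = B} dts)) ,
    blocks-unsequenceable B S unseq

noShortDifferences : ∀ v → Doubling.ShortDifferenceCover v 0 []
noShortDifferences v = record
  { forward  = λ _ _ 0<δ δ≤0 → contradiction δ≤0 (<⇒≱ 0<δ)
  ; backward = λ _ _ 0<δ δ≤0 → contradiction δ≤0 (<⇒≱ 0<δ)
  ; size     = refl
  }

module ShortTriples (v : ℕ) where

  open Doubling v 3

  ≤3⇒<m : ∀ {a} → a ≤ 3 → a < m
  ≤3⇒<m a≤3 = s≤s (≤-trans a≤3 (≤-trans (m≤m+n 3 v) (m≤m+n (3 + v) 3)))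

  ≤3⇒≤m : ∀ {a} → a ≤ 3 → a ≤ m
  ≤3⇒≤m = <⇒≤ ∘ ≤3⇒<m

  new-⊕-≢ : ∀ t a → 0 < a → a ≤ 3 → new (t ⊕ a) ≢ new t
  new-⊕-≢ t a 0<a a≤3 = ⊕-≢ t a 0<a (≤3⇒<m a≤3) ∘ ↑ʳ-injective v _ _

  new-⊕-≢-⊕ : ∀ t a b → a < b → b ≤ 3 → new (t ⊕ a) ≢ new (t ⊕ b)
  new-⊕-≢-⊕ t a b a<b b≤3 = ⊕-≢-⊕ t a b a<b (≤3⇒<m b≤3) ∘ ↑ʳ-injective v _ _

  ascending : Fin m → TransTriple w
  ascending t = ⟨ new t , new (t ⊕ 1) , new (t ⊕ 3) ⟩
    (new-⊕-≢ t 1 (s≤s z≤n) (s≤s z≤n) ∘ sym)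
    (new-⊕-≢ t 3 (s≤s z≤n) ≤-refl ∘ sym)
    (new-⊕-≢-⊕ t 1 3 (s≤s (s≤s z≤n)) ≤-refl)

  descending : Fin m → TransTriple w
  descending t = ⟨ new (t ⊕ 3) , new (t ⊕ 2) , new t ⟩
    (new-⊕-≢-⊕ t 2 3 ≤-refl ≤-refl ∘ sym)
    (new-⊕-≢ t 3 (s≤s z≤n) ≤-refl)
    (new-⊕-≢ t 2 (s≤s z≤n) (s≤s (s≤s z≤n)))

  shortTriples : List (TransTriple w)
  shortTriples = map ascending (allFin m) ++ map descending (allFin m)

  ascending∈ : ∀ t → ascending t ∈ shortTriples
  ascending∈ t = Any.++⁺ˡ (∈-map⁺ ascending (∈-allFin t))

  descending∈ : ∀ t → descending t ∈ shortTriples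
  descending∈ t = Any.++⁺ʳ (map ascending (allFin m)) (∈-map⁺ descending (∈-allFin t))

  length-shortTriples : length shortTriples ≡ m + m
  length-shortTriples = trans (length-++ (map ascending (allFin m))) (cong₂ _+_
    (trans (length-map ascending (allFin m)) (length-allFin m))
    (trans (length-map descending (allFin m)) (length-allFin m)))

  shortTriples-cover : ShortDifferenceCover shortTriples
  shortTriples-cover = record { forward = forward ; backward = backward ; size = size }
    where
    forward : ∀ y δ → 0 < δ → δ ≤ 3 → Any (λ t → HasEdge t (new y) (new (y ⊕ δ))) shortTriples
    forward y 1 _ _ = lose (ascending∈ y) (inj₁ (refl , refl))
    forward y 2 _ _ = lose (ascending∈ (y ⊖ 1))
      (inj₂ (inj₂ (cong new (⊖-⊕ y 1 (≤3⇒≤m (s≤s z≤n))) , cong new (⊖-⊕-+ y 1 2 (≤3⇒≤m (s≤s z≤n))))))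
    forward y 3 _ _ = lose (ascending∈ y) (inj₂ (inj₁ (refl , refl)))
    forward y (suc (suc (suc (suc _)))) _ (s≤s (s≤s (s≤s ())))
    backward : ∀ y δ → 0 < δ → δ ≤ 3 → Any (λ t → HasEdge t (new (y ⊕ δ)) (new y)) shortTriples
    backward y 1 _ _ = lose (descending∈ (y ⊖ 2))
      (inj₁ (cong new (⊖-⊕-+ y 2 1 (≤3⇒≤m (s≤s (s≤s z≤n)))) , cong new (⊖-⊕ y 2 (≤3⇒≤m (s≤s (s≤s z≤n))))))
    backward y 2 _ _ = lose (descending∈ y) (inj₂ (inj₂ (refl , refl)))
    backward y 3 _ _ = lose (descending∈ y) (inj₂ (inj₁ (refl , refl)))
    backward y (suc (suc (suc (suc _)))) _ (s≤s (s≤s (s≤s ())))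
    size : 3 * length shortTriples ≡ 2 * 3 * m
    size = trans (cong (3 *_) length-shortTriples) (six m)
      where
      six : ∀ m → 3 * (m + m) ≡ 2 * 3 * m
      six = solve-∀

double+1 : ∀ {v} → NoGoodDTS v → NoGoodDTS (1 + 2 * v)
double+1 {v} = subst NoGoodDTS (order v) ∘ Doubling.doubling v 0 [] (noShortDifferences v)
  where
  order : ∀ v → v + suc (0 + v + 0) ≡ 1 + 2 * v
  order = solve-∀

double+7 : ∀ {v} → NoGoodDTS v → NoGoodDTS (7 + 2 * v)
double+7 {v} =
  subst NoGoodDTS (order v) ∘ Doubling.doubling v 3 (ShortTriples.shortTriples v) (ShortTriples.shortTriples-cover v)
  where
  order : ∀ v → v + suc (3 + v + 3) ≡ 7 + 2 * v
  order = solve-∀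

-- The seeds of orders 7, 9 and 13

triple : ∀ {n} (a b c : Fin n) → {True (¬? (a ≟ b) ×-dec ¬? (a ≟ c) ×-dec ¬? (b ≟ c))} → TransTriple n
triple a b c {distinct} with toWitness distinct
... | a≢b , a≢c , b≢c = ⟨ a , b , c ⟩ a≢b a≢c b≢c

isDTS? : ∀ {v} (B : List (TransTriple v)) → Dec (IsDTS v B)
isDTS? B = all? λ a → all? λ b → ¬? (a ≟ b) →-dec (edgeCount B a b ≟ℕ 1)

seed : ∀ {v} (B : List (TransTriple v)) {_ : True (isDTS? B)} → Search.layer B v ≡ [] → NoGoodDTS v
seed B {dts} empty = B , toWitness dts , Search.layer-empty⇒unsequenceable B empty

-- The developments of the base blocks (0,1,3), (0,6,4) mod 7; of (1,3,4), (1,7,6), (1,0,5) mod 8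
-- on 1 … 8 with 0 fixed; and of (0,1,4), (0,2,7), (0,11,6), (0,12,9) mod 13.
seedBlocks7 : List (TransTriple 7)
seedBlocks7 =
  triple (# 0) (# 1) (# 3) ∷ triple (# 1) (# 2) (# 4) ∷ triple (# 2) (# 3) (# 5) ∷ triple (# 3) (# 4) (# 6) ∷
  triple (# 4) (# 5) (# 0) ∷ triple (# 5) (# 6) (# 1) ∷ triple (# 6) (# 0) (# 2) ∷ triple (# 0) (# 6) (# 4) ∷
  triple (# 1) (# 0) (# 5) ∷ triple (# 2) (# 1) (# 6) ∷ triple (# 3) (# 2) (# 0) ∷ triple (# 4) (# 3) (# 1) ∷
  triple (# 5) (# 4) (# 2) ∷ triple (# 6) (# 5) (# 3) ∷
  []

seedBlocks9 : List (TransTriple 9)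
seedBlocks9 =
  triple (# 1) (# 3) (# 4) ∷ triple (# 2) (# 4) (# 5) ∷ triple (# 3) (# 5) (# 6) ∷ triple (# 4) (# 6) (# 7) ∷
  triple (# 5) (# 7) (# 8) ∷ triple (# 6) (# 8) (# 1) ∷ triple (# 7) (# 1) (# 2) ∷ triple (# 8) (# 2) (# 3) ∷
  triple (# 1) (# 7) (# 6) ∷ triple (# 2) (# 8) (# 7) ∷ triple (# 3) (# 1) (# 8) ∷ triple (# 4) (# 2) (# 1) ∷
  triple (# 5) (# 3) (# 2) ∷ triple (# 6) (# 4) (# 3) ∷ triple (# 7) (# 5) (# 4) ∷ triple (# 8) (# 6) (# 5) ∷
  triple (# 1) (# 0) (# 5) ∷ triple (# 2) (# 0) (# 6) ∷ triple (# 3) (# 0) (# 7) ∷ triple (# 4) (# 0) (# 8) ∷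
  triple (# 5) (# 0) (# 1) ∷ triple (# 6) (# 0) (# 2) ∷ triple (# 7) (# 0) (# 3) ∷ triple (# 8) (# 0) (# 4) ∷
  []

seedBlocks13 : List (TransTriple 13)
seedBlocks13 =
  triple (# 0) (# 1) (# 4) ∷ triple (# 1) (# 2) (# 5) ∷ triple (# 2) (# 3) (# 6) ∷ triple (# 3) (# 4) (# 7) ∷
  triple (# 4) (# 5) (# 8) ∷ triple (# 5) (# 6) (# 9) ∷ triple (# 6) (# 7) (# 10) ∷ triple (# 7) (# 8) (# 11) ∷
  triple (# 8) (# 9) (# 12) ∷ triple (# 9) (# 10) (# 0) ∷ triple (# 10) (# 11) (# 1) ∷ triple (# 11) (# 12) (# 2) ∷
  triple (# 12) (# 0) (# 3) ∷ triple (# 0) (# 2) (# 7) ∷ triple (# 1) (# 3) (# 8) ∷ triple (# 2) (# 4) (# 9) ∷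
  triple (# 3) (# 5) (# 10) ∷ triple (# 4) (# 6) (# 11) ∷ triple (# 5) (# 7) (# 12) ∷ triple (# 6) (# 8) (# 0) ∷
  triple (# 7) (# 9) (# 1) ∷ triple (# 8) (# 10) (# 2) ∷ triple (# 9) (# 11) (# 3) ∷ triple (# 10) (# 12) (# 4) ∷
  triple (# 11) (# 0) (# 5) ∷ triple (# 12) (# 1) (# 6) ∷ triple (# 0) (# 11) (# 6) ∷ triple (# 1) (# 12) (# 7) ∷
  triple (# 2) (# 0) (# 8) ∷ triple (# 3) (# 1) (# 9) ∷ triple (# 4) (# 2) (# 10) ∷ triple (# 5) (# 3) (# 11) ∷
  triple (# 6) (# 4) (# 12) ∷ triple (# 7) (# 5) (# 0) ∷ triple (# 8) (# 6) (# 1) ∷ triple (# 9) (# 7) (# 2) ∷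
  triple (# 10) (# 8) (# 3) ∷ triple (# 11) (# 9) (# 4) ∷ triple (# 12) (# 10) (# 5) ∷ triple (# 0) (# 12) (# 9) ∷
  triple (# 1) (# 0) (# 10) ∷ triple (# 2) (# 1) (# 11) ∷ triple (# 3) (# 2) (# 12) ∷ triple (# 4) (# 3) (# 0) ∷
  triple (# 5) (# 4) (# 1) ∷ triple (# 6) (# 5) (# 2) ∷ triple (# 7) (# 6) (# 3) ∷ triple (# 8) (# 7) (# 4) ∷
  triple (# 9) (# 8) (# 5) ∷ triple (# 10) (# 9) (# 6) ∷ triple (# 11) (# 10) (# 7) ∷ triple (# 12) (# 11) (# 8) ∷
  []

-- The orders 1 + 6n and 3 + 6n from 7 on

data Parity : ℕ → Set where
  even : ∀ h → Parity (h + h)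
  odd  : ∀ h → Parity (suc (h + h))

parity : ∀ n → Parity n
parity zero = even 0
parity (suc n) with parity n
... | even h = odd h
... | odd h  = subst Parity (cong suc (+-suc h h)) (even (suc h))

noGoodDTS-6n : ∀ n → NoGoodDTS (7 + 6 * n) × NoGoodDTS (9 + 6 * n)
noGoodDTS-6n = <-rec P step
  where
  P : ℕ → Set
  P n = NoGoodDTS (7 + 6 * n) × NoGoodDTS (9 + 6 * n)
  step : ∀ n → (∀ {k} → k < n → P k) → P n
  step 0 _   = seed seedBlocks7 refl , seed seedBlocks9 refl
  step 1 rec = seed seedBlocks13 refl , double+1 (proj₁ (rec (s≤s z≤n)))
  step (suc (suc n)) rec with parity n
  ... | even h =
    subst NoGoodDTS (e₁ h) (double+1 (proj₂ (rec h<))) , subst NoGoodDTS (e₂ h) (double+7 (proj₁ (rec h<)))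
    where
    h< : h < 2 + (h + h)
    h< = s≤s (≤-trans (m≤m+n h h) (n≤1+n (h + h)))
    e₁ : ∀ h → 1 + 2 * (9 + 6 * h) ≡ 7 + 6 * (2 + (h + h))
    e₁ = solve-∀
    e₂ : ∀ h → 7 + 2 * (7 + 6 * h) ≡ 9 + 6 * (2 + (h + h))
    e₂ = solve-∀
  ... | odd h  =
    subst NoGoodDTS (e₃ h) (double+7 (proj₂ (rec h<))) , subst NoGoodDTS (e₄ h) (double+1 (proj₁ (rec 1+h<)))
    where
    1+h< : suc h < 3 + (h + h)
    1+h< = s≤s (s≤s (≤-trans (m≤m+n h h) (n≤1+n (h + h))))
    h< : h < 3 + (h + h)
    h< = ≤-trans (n≤1+n (suc h)) 1+h<
    e₃ : ∀ h → 7 + 2 * (9 + 6 * h) ≡ 7 + 6 * (3 + (h + h))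
    e₃ = solve-∀
    e₄ : ∀ h → 1 + 2 * (7 + 6 * suc h) ≡ 9 + 6 * (3 + (h + h))
    e₄ = solve-∀

admissible⇒6n : ∀ v → (v % 6 ≡ 1 ⊎ v % 6 ≡ 3) → v ≥ 7 → ∃ λ n → v ≡ 7 + 6 * n ⊎ v ≡ 9 + 6 * n
admissible⇒6n v admissible v≥7 with v / 6 | m≡m%n+[m/n]*n v 6
... | zero  | v≡r+0 =
  contradiction (≤-trans v≥7 (≤-reflexive (trans v≡r+0 (+-identityʳ (v % 6))))) (<⇒≱ (≤-trans (m%n<n v 6) (n≤1+n 6)))
... | suc n | v≡r+6q = n , ⊎-map (λ r≡1 → trans v≡r+6q (trans (cong (_+ suc n * 6) r≡1) (e₁ n)))
                               (λ r≡3 → trans v≡r+6q (trans (cong (_+ suc n * 6) r≡3) (e₃ n))) admissible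
  where
  e₁ : ∀ n → 1 + suc n * 6 ≡ 7 + 6 * n
  e₁ = solve-∀
  e₃ : ∀ n → 3 + suc n * 6 ≡ 9 + 6 * n
  e₃ = solve-∀

noGoodDTS : ∀ v → (v % 6 ≡ 1 ⊎ v % 6 ≡ 3) → v ≥ 7 → NoGoodDTS v
noGoodDTS v admissible v≥7 with admissible⇒6n v admissible v≥7
... | n , inj₁ refl = proj₁ (noGoodDTS-6n n)
... | n , inj₂ refl = proj₂ (noGoodDTS-6n n)

corollary5p4 : (v : ℕ) → (v % 6 ≡ 1 ⊎ v % 6 ≡ 3) → v ≥ 7 →
    Σ (List (TransTriple v)) λ B →
    IsDTS v B × ((σ : Fin v ⤖ Fin v) → ¬ IsGoodSequencing B σ)
corollary5p4 v admissible v≥7 with noGoodDTS v admissible v≥7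
... | B , dts , unsequenceable = B , dts , unsequenceable⇒¬good unsequenceable
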